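{- Let $\mathcal{A}$ be a finite totally ordered alphabet, let $w\in\mathcal{A}^{+}$ be a Lyndon word with $|w|\ge F_n$ for some $n\ge 3$, and let $\mathtt{a},\mathtt{b}\in\mathcal{A}$ and $p_w\in\mathcal{A}^*$ be such that $w=\mathtt{a}p_w\mathtt{b}$. Then $w$ is a Fibonacci Lyndon word over $\{\mathtt{a},\mathtt{b}\}$ of length $F_n$ if and only if either $\mathtt{a}p_w$ has period $F_{n-1}$ and $p_w\mathtt{b}$ has period $F_{n-2}$, or $\mathtt{a}p_w$ has period $F_{n-2}$ and $p_w\mathtt{b}$ has period $F_{n-1}$.
   Context: A word $u=u_1\cdots u_m$ has period $p\ge1$ if $u_{i+p}=u_i$ for all $1\le i\le m-p$ (so every $p\ge m$ is a period). Lyndon words: nonempty primitive words strictly smallest in their conjugacy class under the lexicographic order. Fibonacci numbers: $F_0=0,F_1=1,F_n=F_{n-1}+F_{n-2}$. For letters $\mathtt{a}<\mathtt{b}$, set $f_1=\mathtt{b}$, $f_2=\mathtt{a}$, $f_n=f_{n-1}f_{n-2}$; for $n\ge 3$ let $p_n$ be $f_n$ with its last two letters removed; with $c$ the morphism swapping $\mathtt{a},\mathtt{b}$, the Fibonacci Lyndon words of length $F_n$ over $\{\mathtt{a},\mathtt{b}\}$ are $\mathtt{a}p_n\mathtt{b}$ and $\mathtt{a}c(p_n)\mathtt{b}$. -}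

module Defs where

open import Data.Nat using (ℕ; zero; suc; _+_; _∸_; _<_; _≤_)
open import Data.Fin as F using (Fin)
open import Data.Bool using (Bool; true; false; not)
open import Data.List using (List; []; _∷_; _++_; length; map; take; concat; replicate)
open import Data.Maybe using (Maybe; just; nothing)
open import Data.Product using (Σ; _×_; _,_)
open import Data.Sum using (_⊎_)
open import Relation.Binary.PropositionalEquality using (_≡_; _≢_)
open import Relation.Nullary using (¬_)
open import Data.List.Relation.Binary.Lex.Strict using (Lex-<)

-- A finite totally ordered alphabet: Fin k with its usual order.
Word : ℕ → Set
Word k = List (Fin k)

-- strict lexicographic order (proper prefixes are smaller)
_<lex_ : ∀ {k} → Word k → Word k → Set
_<lex_ = Lex-< _≡_ F._<_

_^^_ : ∀ {k} → Word k → ℕ → Word k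
u ^^ m = concat (replicate m u)

Primitive : ∀ {k} → Word k → Set
Primitive w = ¬ (Σ (Word _) λ u → Σ ℕ λ m → 2 ≤ m × w ≡ u ^^ m)

-- conjugates of w are the words v ++ u with w ≡ u ++ v
IsLyndon : ∀ {k} → Word k → Set
IsLyndon w = (w ≢ []) × Primitive w ×
  (∀ u v → w ≡ u ++ v → v ++ u ≢ w → w <lex (v ++ u))

-- 0-indexed letter access
at : ∀ {A : Set} → List A → ℕ → Maybe A
at []       _       = nothing
at (x ∷ xs) zero    = just x
at (x ∷ xs) (suc i) = at xs i

HasPeriod : ∀ {A : Set} → List A → ℕ → Set
HasPeriod u p = 1 ≤ p × (∀ i → i + p < length u → at u (i + p) ≡ at u i)

fib : ℕ → ℕ
fib 0 = 0
fib 1 = 1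
fib (suc (suc n)) = fib (suc n) + fib n

-- Fibonacci words f_n over {false = a, true = b}: f_1 = b, f_2 = a, f_n = f_{n-1} f_{n-2}
-- (f_0 is unused; set to []).
fibW : ℕ → List Bool
fibW 0 = []
fibW 1 = true ∷ []
fibW 2 = false ∷ []
fibW (suc (suc (suc n))) = fibW (suc (suc n)) ++ fibW (suc n)

pW : ℕ → List Bool
pW n = take (length (fibW n) ∸ 2) (fibW n)

interp : ∀ {k} → Fin k → Fin k → Bool → Fin k
interp a b false = a
interp a b true  = b

IsFibLyndon : ∀ {k} → Fin k → Fin k → ℕ → Word k → Set
IsFibLyndon a b n w = a F.< b ×
  ( (w ≡ a ∷ (map (interp a b) (pW n) ++ b ∷ []))
  ⊎ (w ≡ a ∷ (map (interp a b) (map not (pW n)) ++ b ∷ [])) )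

module Submission where

-- Write n = m + 3, so the periods F_{n-1}, F_{n-2} are F_{m+2}, F_{m+1}.
-- Core: view a word w_0 … w_M as a function ℕ → X, "bi-periodic" with (P, Q)
-- when w_0 … w_{M-1} has period P and w_1 … w_M has period Q.  A Euclid step
-- (q+r, q) ↦ (r, q) on a prefix, or (q, q+r) ↦ (q, r) on a suffix, lowers the
-- Fibonacci level, and agreement of two words spreads back through the removed
-- period.  By induction on the level, such a word with Fibonacci periods is
-- constant if longer than F_n (fib-constant) and is determined by its first and
-- last letters if of length exactly F_n (fib-unique).
-- Fibonacci words: f_{m+2} f_{m+1} and f_{m+1} f_{m+2} differ only by exchanging
-- their last two letters; the common prefix p_n of such a swap pair (u, v) has
-- periods |u| and |v|, so a p_n b and a c(p_n) b have the Fibonacci periods in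
-- the two orders.  This is the forward direction.  Conversely, primitivity
-- rules out length > F_n and a = b, the Lyndon property gives a < b, and
-- fib-unique identifies w with the candidate of the same period order.

open import Defs
open import Data.Nat using (ℕ; _≤_; _∸_)
open import Data.Fin using (Fin)
open import Data.List using (List; _∷_; []; _++_; length)
open import Data.Product using (_×_)
open import Data.Sum using (_⊎_)
open import Relation.Binary.PropositionalEquality using (_≡_)
open import Function.Bundles using (_⇔_)

open import Data.Nat using (suc; zero; _+_; _<_; z≤n; s≤s; _<?_; _≤?_)
open import Data.Nat.Properties
open import Data.Nat.Induction using (<-rec)
open import Data.Nat.Tactic.RingSolver using (solve-∀)
open import Data.Bool using (Bool; true; false; not)
open import Data.List using (map; take)
open import Data.List.Properties using (length-++; length-map; map-++; map-∘; ++-assoc; ∷-injectiveˡ; ∷-injectiveʳ; ∷ʳ-injectiveˡ)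
open import Data.List.Relation.Binary.Lex.Core using (this; next)
open import Data.Maybe using (just)
open import Data.Maybe.Properties using (just-injective)
import Data.Fin as F
import Data.Fin.Properties as FP
open import Data.Product using (Σ; _,_; proj₁; proj₂)
open import Data.Sum using (inj₁; inj₂; [_,_])
import Data.Sum as Sum
open import Data.Empty using (⊥-elim)
open import Function using (_∘_)
open import Function.Bundles using (mk⇔)
open import Relation.Binary.PropositionalEquality using (refl; sym; trans; cong; cong₂; subst; subst₂; _≢_; module ≡-Reasoning)
open import Relation.Binary.Definitions using (tri<; tri≈; tri>)
open import Relation.Nullary using (¬_; yes; no)

open ≡-Reasoning

private variable
  A B X : Set

Periodic : (ℕ → X) → ℕ → ℕ → Set
Periodic f M P = ∀ i → i + P < M → f (i + P) ≡ f i

BiPeriodic : (ℕ → X) → ℕ → ℕ → ℕ → Set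
BiPeriodic f M P Q = Periodic f M P × Periodic (λ i → f (suc i)) M Q

const-biperiodic : ∀ (c : X) {M P Q} → BiPeriodic (λ _ → c) M P Q
const-biperiodic c = (λ _ _ → refl) , (λ _ _ → refl)

Periodic-cong : ∀ {f g : ℕ → X} {M P} → (∀ i → i < M → f i ≡ g i) → Periodic f M P → Periodic g M P
Periodic-cong {f = f} {g} {M} {P} same per i lt = begin
  g (i + P) ≡⟨ same (i + P) lt ⟨
  f (i + P) ≡⟨ per i lt ⟩
  f i       ≡⟨ same i (≤-<-trans (m≤m+n i P) lt) ⟩
  g i       ∎

Periodic-≤ : ∀ {f : ℕ → X} {M N P} → N ≤ M → Periodic f M P → Periodic f N P
Periodic-≤ N≤M per i lt = per i (<-≤-trans lt N≤M)

shift-< : ∀ {j N q M} → j < N → N + q ≤ M → j + q < M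
shift-< {q = q} lt le = <-≤-trans (+-monoˡ-< q lt) le

reduce-prefix : ∀ {f : ℕ → X} {M N q r} → 1 ≤ r → N + q ≤ M →
                BiPeriodic f M (q + r) q → BiPeriodic f N r q
reduce-prefix {f = f} {M} {N} {q} {suc r₀} _ N+q≤M (init , tail) =
  init′ , Periodic-≤ (≤-trans (m≤m+n N q) N+q≤M) tail
  where
  reassoc : ∀ i r₀ q → i + suc r₀ + q ≡ suc (i + r₀ + q)
  reassoc = solve-∀
  comm : ∀ i r₀ q → suc (i + r₀ + q) ≡ i + (q + suc r₀)
  comm = solve-∀
  init′ : Periodic f N (suc r₀)
  init′ i lt = begin
    f (i + suc r₀)          ≡⟨ cong f (+-suc i r₀) ⟩
    f (suc (i + r₀))        ≡⟨ tail (i + r₀) (<⇒≤ bound) ⟨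
    f (suc (i + r₀ + q))    ≡⟨ cong f (comm i r₀ q) ⟩
    f (i + (q + suc r₀))    ≡⟨ init i (subst (_< M) (comm i r₀ q) bound) ⟩
    f i                     ∎
    where
    bound : suc (i + r₀ + q) < M
    bound = subst (_< M) (reassoc i r₀ q) (shift-< lt N+q≤M)

reduce-suffix : ∀ {f : ℕ → X} {M N q r} → 1 ≤ r → N + q ≤ M →
                BiPeriodic f M q (q + r) → BiPeriodic (λ i → f (i + q)) N q r
reduce-suffix {f = f} {M} {N} {q} {r} 1≤r N+q≤M (init , tail) = init′ , tail′
  where
  comm : ∀ i r q → suc (i + r) + q ≡ suc (i + (q + r))
  comm = solve-∀
  init′ : Periodic (λ i → f (i + q)) N q
  init′ i lt = init (i + q) (shift-< lt N+q≤M)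
  tail′ : Periodic (λ i → f (suc i + q)) N r
  tail′ i lt = begin
    f (suc (i + r) + q)     ≡⟨ cong f (comm i r q) ⟩
    f (suc (i + (q + r)))   ≡⟨ tail i (subst (_≤ M) (comm i r q) (shift-< lt N+q≤M)) ⟩
    f (suc i)               ≡⟨ init (suc i) (≤-<-trans (+-monoˡ-≤ q (m<m+n i 1≤r)) (shift-< lt N+q≤M)) ⟨
    f (suc i + q)           ∎

periodic-agree : ∀ {f g : ℕ → X} {M P} → 1 ≤ P → Periodic f M P → Periodic g M P →
                 (∀ i → i < P → f i ≡ g i) → ∀ i → i < M → f i ≡ g i
periodic-agree {f = f} {g} {M} {P} 1≤P perf perg start = <-rec (λ i → i < M → f i ≡ g i) step
  where
  step : ∀ i → (∀ {j} → j < i → j < M → f j ≡ g j) → i < M → f i ≡ g i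
  step i rec i<M with i <? P
  ... | yes i<P = start i i<P
  ... | no i≮P = begin
    f i        ≡⟨ cong f split ⟨
    f (d + P)  ≡⟨ perf d d+P<M ⟩
    f d        ≡⟨ rec d<i (<-trans d<i i<M) ⟩
    g d        ≡⟨ perg d d+P<M ⟨
    g (d + P)  ≡⟨ cong g split ⟩
    g i        ∎
    where
    d : ℕ
    d = i ∸ P
    split : d + P ≡ i
    split = m∸n+n≡m (≮⇒≥ i≮P)
    d+P<M : d + P < M
    d+P<M = subst (_< M) (sym split) i<M
    d<i : d < i
    d<i = subst (d <_) split (m<m+n d 1≤P)

extend-by-tail : ∀ {f g : ℕ → X} {M N Q} → 1 ≤ Q → Q ≤ N →
                 Periodic (λ i → f (suc i)) M Q → Periodic (λ i → g (suc i)) M Q →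
                 (∀ i → i ≤ N → f i ≡ g i) → ∀ i → i ≤ M → f i ≡ g i
extend-by-tail _ _ _ _ agree zero _ = agree 0 z≤n
extend-by-tail 1≤Q Q≤N tailf tailg agree (suc i) i<M =
  periodic-agree 1≤Q tailf tailg (λ j j<Q → agree (suc j) (≤-trans j<Q Q≤N)) i i<M

extend-by-init : ∀ {f g : ℕ → X} {M N P} → N + P ≡ M → P ≤ N → Periodic f M P → Periodic g M P →
                 (∀ j → j ≤ N → f (j + P) ≡ g (j + P)) → ∀ i → i ≤ M → f i ≡ g i
extend-by-init {f = f} {g} {M} {N} {P} N+P≡M P≤N initf initg agree i i≤M with P ≤? i
... | yes P≤i = begin
  f i              ≡⟨ cong f (m∸n+n≡m P≤i) ⟨
  f (i ∸ P + P)    ≡⟨ agree (i ∸ P) (+-cancelʳ-≤ P (i ∸ P) N (subst₂ _≤_ (sym (m∸n+n≡m P≤i)) (sym N+P≡M) i≤M)) ⟩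
  g (i ∸ P + P)    ≡⟨ cong g (m∸n+n≡m P≤i) ⟩
  g i              ∎
... | no P≰i = begin
  f i        ≡⟨ initf i i+P<M ⟨
  f (i + P)  ≡⟨ agree i (<⇒≤ i<N) ⟩
  g (i + P)  ≡⟨ initg i i+P<M ⟩
  g i        ∎
  where
  i<N : i < N
  i<N = <-≤-trans (≰⇒> P≰i) P≤N
  i+P<M : i + P < M
  i+P<M = subst (i + P <_) N+P≡M (+-monoˡ-< P i<N)

tail-endpoint : ∀ {f : ℕ → X} {M N Q} → 1 ≤ N → N + Q ≡ M → Periodic (λ i → f (suc i)) M Q → f M ≡ f N
tail-endpoint {N = suc d} _ refl tail = tail d ≤-refl

fib-pos : ∀ m → 1 ≤ fib (suc m)
fib-pos zero    = s≤s z≤n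
fib-pos (suc m) = ≤-trans (fib-pos m) (m≤m+n (fib (suc m)) (fib m))

fib-gap : ∀ m → fib (2 + m) < fib (3 + m)
fib-gap m = subst (_≤ fib (3 + m)) (+-comm (fib (2 + m)) 1) (+-monoʳ-≤ (fib (2 + m)) (fib-pos m))

data FibPeriods (m : ℕ) : ℕ → ℕ → Set where
  longFirst  : FibPeriods m (fib (2 + m)) (fib (1 + m))
  shortFirst : FibPeriods m (fib (1 + m)) (fib (2 + m))

split-exact : ∀ m {M} → suc M ≡ fib (4 + m) →
              Σ ℕ λ N → (N + fib (2 + m) ≡ M) × (suc N ≡ fib (3 + m))
split-exact m {M} len = M ∸ q , m∸n+n≡m q≤M , (begin
  suc (M ∸ q)          ≡⟨ +-∸-assoc 1 q≤M ⟨
  suc M ∸ q            ≡⟨ cong (_∸ q) len ⟩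
  fib (3 + m) + q ∸ q  ≡⟨ m+n∸n≡m (fib (3 + m)) q ⟩
  fib (3 + m)          ∎)
  where
  q : ℕ
  q = fib (2 + m)
  q≤M : q ≤ M
  q≤M = ≤-pred (subst (q <_) (sym len) (m<n+m q (fib-pos (2 + m))))

split-long : ∀ m {M} → fib (4 + m) ≤ M →
             Σ ℕ λ N → (N + fib (2 + m) ≡ M) × (fib (3 + m) ≤ N)
split-long m {M} long =
  M ∸ q , m∸n+n≡m (≤-trans (m≤n+m q (fib (3 + m))) long) ,
  subst (_≤ M ∸ q) (m+n∸n≡m (fib (3 + m)) q) (∸-monoˡ-≤ q long)
  where
  q : ℕ
  q = fib (2 + m)

period-one : ∀ {f : ℕ → X} {M} → 2 ≤ M → BiPeriodic f M 1 1 → ∀ i → i ≤ M → f i ≡ f 0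
period-one {f = f} 2≤M (init , tail) = extend-by-tail ≤-refl ≤-refl tail (λ _ _ → refl) start
  where
  start : ∀ i → i ≤ 1 → f i ≡ f 0
  start zero          _         = refl
  start (suc zero)    _         = init 0 2≤M
  start (suc (suc _)) (s≤s ())

fib-constant : ∀ {m P Q} → FibPeriods m P Q → ∀ {f : ℕ → X} {M} → fib (3 + m) ≤ M →
               BiPeriodic f M P Q → ∀ i → i ≤ M → f i ≡ f 0
fib-constant {m = zero} longFirst  = period-one
fib-constant {m = zero} shortFirst = period-one
fib-constant {m = suc m} longFirst long (init , tail) with split-long m long
... | N , N+q≡M , longN =
  extend-by-tail (fib-pos (1 + m)) (≤-trans (<⇒≤ (fib-gap m)) longN) tail (λ _ _ → refl)
    (fib-constant {m = m} shortFirst longN (reduce-prefix (fib-pos m) (≤-reflexive N+q≡M) (init , tail)))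
fib-constant {m = suc m} shortFirst {f} long (init , tail) with split-long m long
... | N , N+q≡M , longN =
  extend-by-init N+q≡M q≤N init (λ _ _ → refl)
    (λ j j≤N → trans (fib-constant {m = m} longFirst longN (reduce-suffix (fib-pos m) (≤-reflexive N+q≡M) (init , tail)) j j≤N)
                     (init 0 q<M))
  where
  q : ℕ
  q = fib (2 + m)
  q≤N : q ≤ N
  q≤N = ≤-trans (<⇒≤ (fib-gap m)) longN
  q<M : q < _
  q<M = subst (q <_) N+q≡M (m<n+m q (≤-trans (fib-pos (1 + m)) q≤N))

fib-unique : ∀ {m P Q} → FibPeriods m P Q → ∀ {f g : ℕ → X} {M} → suc M ≡ fib (3 + m) →
             BiPeriodic f M P Q → BiPeriodic g M P Q → f 0 ≡ g 0 → f M ≡ g M → ∀ i → i ≤ M → f i ≡ g i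
fib-unique {m = zero} _ refl _ _ first _    zero          _ = first
fib-unique {m = zero} _ refl _ _ _    last (suc zero)    _ = last
fib-unique {m = zero} _ refl _ _ _    _    (suc (suc _)) (s≤s ())
fib-unique {m = suc m} longFirst {f} {g} len (initf , tailf) (initg , tailg) first last with split-exact m len
... | N , N+q≡M , lenN =
  extend-by-tail (fib-pos (1 + m)) q≤N tailf tailg
    (fib-unique {m = m} shortFirst lenN (reduce-prefix (fib-pos m) (≤-reflexive N+q≡M) (initf , tailf))
                                (reduce-prefix (fib-pos m) (≤-reflexive N+q≡M) (initg , tailg)) first lastN)
  where
  q≤N : fib (2 + m) ≤ N
  q≤N = ≤-pred (subst (fib (2 + m) <_) (sym lenN) (fib-gap m))
  1≤N : 1 ≤ N
  1≤N = ≤-trans (fib-pos (1 + m)) q≤N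
  lastN : f N ≡ g N
  lastN = begin
    f N ≡⟨ tail-endpoint {f = f} 1≤N N+q≡M tailf ⟨
    f _ ≡⟨ last ⟩
    g _ ≡⟨ tail-endpoint {f = g} 1≤N N+q≡M tailg ⟩
    g N ∎
fib-unique {m = suc m} shortFirst {f} {g} len (initf , tailf) (initg , tailg) first last with split-exact m len
... | N , N+q≡M , lenN =
  extend-by-init N+q≡M q≤N initf initg
    (fib-unique {m = m} longFirst lenN (reduce-suffix (fib-pos m) (≤-reflexive N+q≡M) (initf , tailf))
                               (reduce-suffix (fib-pos m) (≤-reflexive N+q≡M) (initg , tailg)) firstN lastN)
  where
  q : ℕ
  q = fib (2 + m)
  q≤N : q ≤ N
  q≤N = ≤-pred (subst (q <_) (sym lenN) (fib-gap m))
  q<M : q < _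
  q<M = subst (q <_) N+q≡M (m<n+m q (≤-trans (fib-pos (1 + m)) q≤N))
  firstN : f q ≡ g q
  firstN = trans (initf 0 q<M) (trans first (sym (initg 0 q<M)))
  lastN : f (N + q) ≡ g (N + q)
  lastN = subst (λ t → f t ≡ g t) (sym N+q≡M) last

at-++ˡ : ∀ (xs ys : List A) {j} → j < length xs → at (xs ++ ys) j ≡ at xs j
at-++ˡ (x ∷ xs) ys {zero}  _        = refl
at-++ˡ (x ∷ xs) ys {suc j} (s≤s lt) = at-++ˡ xs ys lt

at-++ʳ : ∀ (xs ys : List A) j → at (xs ++ ys) (length xs + j) ≡ at ys j
at-++ʳ []       ys j = refl
at-++ʳ (x ∷ xs) ys j = at-++ʳ xs ys j

at-++-length : ∀ (xs : List A) y ys → at (xs ++ y ∷ ys) (length xs) ≡ just y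
at-++-length []       y ys = refl
at-++-length (x ∷ xs) y ys = at-++-length xs y ys

length-snoc : ∀ (xs : List A) y → length (xs ++ y ∷ []) ≡ suc (length xs)
length-snoc []       y = refl
length-snoc (x ∷ xs) y = cong suc (length-snoc xs y)

at-ext : ∀ (xs ys : List A) → length xs ≡ length ys → (∀ i → i < length xs → at xs i ≡ at ys i) → xs ≡ ys
at-ext []       []       _  _     = refl
at-ext (x ∷ xs) (y ∷ ys) eq agree =
  cong₂ _∷_ (just-injective (agree 0 (s≤s z≤n))) (at-ext xs ys (suc-injective eq) (λ i lt → agree (suc i) (s≤s lt)))

constant-word : ∀ {K} (xs : Word K) c → (∀ i → i < length xs → at xs i ≡ just c) → xs ≡ (c ∷ []) ^^ length xs
constant-word []       c _    = refl
constant-word (x ∷ xs) c same =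
  cong₂ _∷_ (just-injective (same 0 (s≤s z≤n))) (constant-word xs c (λ i lt → same (suc i) (s≤s lt)))

take-length-++ : ∀ (xs ys : List A) → take (length xs) (xs ++ ys) ≡ xs
take-length-++ []       ys = refl
take-length-++ (x ∷ xs) ys = cong (x ∷_) (take-length-++ xs ys)

period-snoc : ∀ {x : List A} {c p} → 1 ≤ p → Periodic (at x) (length x) p →
              (∀ i → i + p ≡ length x → at x i ≡ just c) → HasPeriod (x ++ c ∷ []) p
period-snoc {x = x} {c} {p} 1≤p per end = 1≤p , step
  where
  i<x : ∀ {i} → i + p ≤ length x → i < length x
  i<x le = <-≤-trans (m<m+n _ 1≤p) le
  step : ∀ i → i + p < length (x ++ c ∷ []) → at (x ++ c ∷ []) (i + p) ≡ at (x ++ c ∷ []) i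
  step i lt with m≤n⇒m<n∨m≡n (≤-pred (subst (i + p <_) (length-snoc x c) lt))
  ... | inj₁ inside = begin
    at (x ++ c ∷ []) (i + p) ≡⟨ at-++ˡ x _ inside ⟩
    at x (i + p)             ≡⟨ per i inside ⟩
    at x i                   ≡⟨ at-++ˡ x _ (i<x (<⇒≤ inside)) ⟨
    at (x ++ c ∷ []) i       ∎
  ... | inj₂ last = begin
    at (x ++ c ∷ []) (i + p)        ≡⟨ cong (at (x ++ c ∷ [])) last ⟩
    at (x ++ c ∷ []) (length x)     ≡⟨ at-++-length x c [] ⟩
    just c                          ≡⟨ end i last ⟨
    at x i                          ≡⟨ at-++ˡ x _ (i<x (≤-reflexive last)) ⟨
    at (x ++ c ∷ []) i              ∎

period-cons : ∀ {x : List A} {c p} → 1 ≤ p → Periodic (at x) (length x) p →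
              (∀ j → suc j ≡ p → j < length x → at x j ≡ just c) → HasPeriod (c ∷ x) p
period-cons {x = x} {c} {suc p₀} 1≤p per start = 1≤p , step
  where
  step : ∀ i → i + suc p₀ < suc (length x) → at (c ∷ x) (i + suc p₀) ≡ at (c ∷ x) i
  step zero    (s≤s lt) = start p₀ refl lt
  step (suc i) (s≤s lt) = per i lt

record SwapPair (u v x : List A) (α β : A) : Set where
  constructor swap-pair
  field
    uv≡ : u ++ v ≡ x ++ α ∷ β ∷ []
    vu≡ : v ++ u ≡ x ++ β ∷ α ∷ []

swap-sym : ∀ {u v x : List A} {α β} → SwapPair u v x α β → SwapPair v u x β α
swap-sym (swap-pair uv vu) = swap-pair vu uv

swap-step : ∀ {u v x : List A} {α β} → SwapPair u v x α β → SwapPair (u ++ v) u (u ++ x) β α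
swap-step {u = u} {v} {x} {α} {β} (swap-pair uv vu) = swap-pair
  (begin
    (u ++ v) ++ u          ≡⟨ ++-assoc u v u ⟩
    u ++ (v ++ u)          ≡⟨ cong (u ++_) vu ⟩
    u ++ (x ++ β ∷ α ∷ []) ≡⟨ ++-assoc u x _ ⟨
    (u ++ x) ++ β ∷ α ∷ [] ∎)
  (begin
    u ++ (u ++ v)          ≡⟨ cong (u ++_) uv ⟩
    u ++ (x ++ α ∷ β ∷ []) ≡⟨ ++-assoc u x _ ⟨
    (u ++ x) ++ α ∷ β ∷ [] ∎)

swap-map : ∀ (g : A → B) {u v x α β} → SwapPair u v x α β →
           SwapPair (map g u) (map g v) (map g x) (g α) (g β)
swap-map g {u} {v} {x} (swap-pair uv vu) = swap-pair
  (trans (sym (map-++ g u v)) (trans (cong (map g) uv) (map-++ g x _)))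
  (trans (sym (map-++ g v u)) (trans (cong (map g) vu) (map-++ g x _)))

exchange : ∀ (u v : List A) {i} → i < length v → at (u ++ v) (length u + i) ≡ at (v ++ u) i
exchange u v lt = trans (at-++ʳ u v _) (sym (at-++ˡ v u lt))

swap-periods : ∀ {u v x : List A} {α β} → SwapPair u v x α β → 1 ≤ length u →
               HasPeriod (α ∷ x) (length u) × HasPeriod (x ++ α ∷ []) (length u)
swap-periods {u = u} {v} {x} {α} {β} (swap-pair uv vu) 1≤p =
  period-cons {x = x} 1≤p periodic start , period-snoc {x = x} 1≤p periodic end
  where
  p ℓ : ℕ
  p = length u
  ℓ = length x
  size : suc (suc ℓ) ≡ p + length v
  size = begin
    suc (suc ℓ)                   ≡⟨ +-comm 2 ℓ ⟩
    ℓ + 2                         ≡⟨ length-++ x ⟨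
    length (x ++ α ∷ β ∷ [])      ≡⟨ cong length uv ⟨
    length (u ++ v)               ≡⟨ length-++ u ⟩
    p + length v                  ∎
  shift : ∀ i → i + p ≤ ℓ → at (x ++ α ∷ β ∷ []) (i + p) ≡ at x i
  shift i le = begin
    at (x ++ α ∷ β ∷ []) (i + p)  ≡⟨ cong₂ at (sym uv) (+-comm i p) ⟩
    at (u ++ v) (p + i)           ≡⟨ exchange u v i<v ⟩
    at (v ++ u) i                 ≡⟨ cong (λ w → at w i) vu ⟩
    at (x ++ β ∷ α ∷ []) i        ≡⟨ at-++ˡ x _ (<-≤-trans (m<m+n i 1≤p) le) ⟩
    at x i                        ∎
    where
    i<v : i < length v
    i<v = +-cancelʳ-< p i (length v)
            (subst (i + p <_) (trans size (+-comm p (length v))) (≤-trans (s≤s le) (n≤1+n _)))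
  periodic : Periodic (at x) ℓ p
  periodic i lt = trans (sym (at-++ˡ x _ lt)) (shift i (<⇒≤ lt))
  end : ∀ i → i + p ≡ ℓ → at x i ≡ just α
  end i eq = begin
    at x i                        ≡⟨ shift i (≤-reflexive eq) ⟨
    at (x ++ α ∷ β ∷ []) (i + p)  ≡⟨ cong (at (x ++ α ∷ β ∷ [])) eq ⟩
    at (x ++ α ∷ β ∷ []) ℓ        ≡⟨ at-++-length x α _ ⟩
    just α                        ∎
  start : ∀ j → suc j ≡ p → j < ℓ → at x j ≡ just α
  start j eq lt = begin
    at x j                        ≡⟨ at-++ˡ x _ lt ⟨
    at (x ++ α ∷ β ∷ []) j        ≡⟨ cong (λ w → at w j) uv ⟨
    at (u ++ v) j                 ≡⟨ exchange v u (subst (j <_) eq ≤-refl) ⟨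
    at (v ++ u) (length v + j)    ≡⟨ cong₂ at vu last ⟩
    at (x ++ β ∷ α ∷ []) (ℓ + 1)  ≡⟨ at-++ʳ x (β ∷ α ∷ []) 1 ⟩
    just α                        ∎
    where
    last : length v + j ≡ ℓ + 1
    last = suc-injective (begin
      suc (length v + j)  ≡⟨ +-suc (length v) j ⟨
      length v + suc j    ≡⟨ cong (length v +_) eq ⟩
      length v + p        ≡⟨ +-comm (length v) p ⟩
      p + length v        ≡⟨ size ⟨
      suc (suc ℓ)         ≡⟨ cong suc (+-comm 1 ℓ) ⟩
      suc (ℓ + 1)         ∎)

Pattern : A → A → List A → ℕ → ℕ → Set
Pattern c d y P Q = HasPeriod (c ∷ y) P × HasPeriod (y ++ d ∷ []) Q

swap-pattern : ∀ {u v y : List A} {c d P Q} → SwapPair u v y c d →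
               length u ≡ P → length v ≡ Q → 1 ≤ P → 1 ≤ Q → Pattern c d y P Q
swap-pattern S refl refl 1≤P 1≤Q = proj₁ (swap-periods S 1≤P) , proj₂ (swap-periods (swap-sym S) 1≤Q)

pattern-biperiodic : ∀ {c d : A} {y P Q} → Pattern c d y P Q →
                     BiPeriodic (at (c ∷ y ++ d ∷ [])) (suc (length y)) P Q
pattern-biperiodic {c = c} {d} {y} {Q = Q} ((_ , init) , (_ , tail)) =
  Periodic-cong (λ i lt → sym (at-++ˡ (c ∷ y) (d ∷ []) lt)) init ,
  subst (λ M → Periodic (at (y ++ d ∷ [])) M Q) (length-snoc y d) tail

pattern-unique : ∀ {m P Q} → FibPeriods m P Q → ∀ {c d : A} {y z} →
                 suc (suc (length y)) ≡ fib (3 + m) → length z ≡ length y →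
                 Pattern c d y P Q → Pattern c d z P Q → y ≡ z
pattern-unique {m = m} {P} {Q} s {c} {d} {y} {z} len same-length paty patz =
  ∷ʳ-injectiveˡ y z (at-ext (y ++ d ∷ []) (z ++ d ∷ []) snoc-length
    (λ i lt → agree (suc i) (subst (i <_) (length-snoc y d) lt)))
  where
  snoc-length : length (y ++ d ∷ []) ≡ length (z ++ d ∷ [])
  snoc-length = trans (length-snoc y d) (trans (cong suc (sym same-length)) (sym (length-snoc z d)))
  bz : BiPeriodic (at (c ∷ z ++ d ∷ [])) (suc (length y)) P Q
  bz = subst (λ M → BiPeriodic (at (c ∷ z ++ d ∷ [])) M P Q) (cong suc same-length) (pattern-biperiodic {c = c} {d} {z} patz)
  lasts : at (y ++ d ∷ []) (length y) ≡ at (z ++ d ∷ []) (length y)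
  lasts = trans (at-++-length y d []) (sym (subst (λ t → at (z ++ d ∷ []) t ≡ just d) same-length (at-++-length z d [])))
  agree : ∀ i → i ≤ suc (length y) → at (c ∷ y ++ d ∷ []) i ≡ at (c ∷ z ++ d ∷ []) i
  agree = fib-unique s len (pattern-biperiodic {c = c} {d} {y} paty) bz refl lasts

length-fibW : ∀ m → length (fibW (suc m)) ≡ fib (suc m)
length-fibW zero          = refl
length-fibW (suc zero)    = refl
length-fibW (suc (suc m)) =
  trans (length-++ (fibW (2 + m))) (cong₂ _+_ (length-fibW (suc m)) (length-fibW m))

fib-swap : ∀ m → Σ (List Bool) λ x →
           SwapPair (fibW (2 + m)) (fibW (1 + m)) x false true ⊎ SwapPair (fibW (2 + m)) (fibW (1 + m)) x true false
fib-swap zero = [] , inj₁ (swap-pair refl refl)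
fib-swap (suc m) with fib-swap m
... | x , inj₁ S = fibW (2 + m) ++ x , inj₂ (swap-step S)
... | x , inj₂ S = fibW (2 + m) ++ x , inj₁ (swap-step S)

fib-swap-prefix : ∀ m {x α β} → SwapPair (fibW (2 + m)) (fibW (1 + m)) x α β → pW (3 + m) ≡ x
fib-swap-prefix m {x} {α} {β} (swap-pair uv _) = begin
  pW (3 + m)                                               ≡⟨ cong (λ w → take (length w ∸ 2) w) uv ⟩
  take (length (x ++ α ∷ β ∷ []) ∸ 2) (x ++ α ∷ β ∷ [])   ≡⟨ cong (λ n → take n (x ++ α ∷ β ∷ [])) drop-two ⟩
  take (length x) (x ++ α ∷ β ∷ [])                        ≡⟨ take-length-++ x _ ⟩
  x                                                        ∎
  where
  drop-two : length (x ++ α ∷ β ∷ []) ∸ 2 ≡ length x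
  drop-two = trans (cong (_∸ 2) (length-++ x)) (m+n∸n≡m (length x) 2)

length-pW : ∀ m → suc (suc (length (pW (3 + m)))) ≡ fib (3 + m)
length-pW m with fib-swap m
... | x , S = Sum.[ prefix-length , prefix-length ] S
  where
  prefix-length : ∀ {α β} → SwapPair (fibW (2 + m)) (fibW (1 + m)) x α β → suc (suc (length (pW (3 + m)))) ≡ fib (3 + m)
  prefix-length {α} {β} S@(swap-pair uv _) = begin
    suc (suc (length (pW (3 + m))))  ≡⟨ cong (suc ∘ suc ∘ length) (fib-swap-prefix m S) ⟩
    suc (suc (length x))             ≡⟨ +-comm 2 (length x) ⟩
    length x + 2                     ≡⟨ length-++ x ⟨
    length (x ++ α ∷ β ∷ [])         ≡⟨ cong length uv ⟨
    length (fibW (3 + m))            ≡⟨ length-fibW (2 + m) ⟩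
    fib (3 + m)                      ∎

fib-pattern : ∀ m (g : Bool → A) {x α β} → SwapPair (fibW (2 + m)) (fibW (1 + m)) x α β →
              Pattern (g α) (g β) (map g x) (fib (2 + m)) (fib (1 + m)) ×
              Pattern (g β) (g α) (map g x) (fib (1 + m)) (fib (2 + m))
fib-pattern m g {x} {α} {β} S =
  swap-pattern S′ long short (fib-pos (1 + m)) (fib-pos m) ,
  swap-pattern (swap-sym S′) short long (fib-pos m) (fib-pos (1 + m))
  where
  S′ : SwapPair (map g (fibW (2 + m))) (map g (fibW (1 + m))) (map g x) (g α) (g β)
  S′ = swap-map g S
  long : length (map g (fibW (2 + m))) ≡ fib (2 + m)
  long = trans (length-map g (fibW (2 + m))) (length-fibW (1 + m))
  short : length (map g (fibW (1 + m))) ≡ fib (1 + m)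
  short = trans (length-map g (fibW (1 + m))) (length-fibW m)

module FibonacciLyndon {K : ℕ} (a b : Fin K) (m : ℕ) where

  φ : Bool → Fin K
  φ = interp a b

  y₁ y₂ : Word K
  y₁ = map φ (pW (3 + m))
  y₂ = map φ (map not (pW (3 + m)))

  FibPatterns : List Bool → Set
  FibPatterns x = (Pattern a b (map φ x) (fib (2 + m)) (fib (1 + m)) × Pattern a b (map φ (map not x)) (fib (1 + m)) (fib (2 + m)))
                ⊎ (Pattern a b (map φ x) (fib (1 + m)) (fib (2 + m)) × Pattern a b (map φ (map not x)) (fib (2 + m)) (fib (1 + m)))

  complement : ∀ {x P Q} → Pattern a b (map (φ ∘ not) x) P Q → Pattern a b (map φ (map not x)) P Q
  complement {x} = subst (λ z → Pattern a b z _ _) (map-∘ x)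

  fib-patterns : FibPatterns (pW (3 + m))
  fib-patterns with fib-swap m
  ... | x , inj₁ S = subst FibPatterns (sym (fib-swap-prefix m S))
        (inj₁ (proj₁ (fib-pattern m φ S) , complement (proj₂ (fib-pattern m (φ ∘ not) S))))
  ... | x , inj₂ S = subst FibPatterns (sym (fib-swap-prefix m S))
        (inj₂ (proj₂ (fib-pattern m φ S) , complement (proj₁ (fib-pattern m (φ ∘ not) S))))

  fib-candidate : ∀ {P Q} → FibPeriods m P Q → Σ (Word K) λ z → Pattern a b z P Q × (z ≡ y₁ ⊎ z ≡ y₂)
  fib-candidate longFirst with fib-patterns
  ... | inj₁ (pat₁ , _) = y₁ , pat₁ , inj₁ refl
  ... | inj₂ (_ , pat₂) = y₂ , pat₂ , inj₂ refl
  fib-candidate shortFirst with fib-patterns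
  ... | inj₁ (_ , pat₂) = y₂ , pat₂ , inj₂ refl
  ... | inj₂ (pat₁ , _) = y₁ , pat₁ , inj₁ refl

  candidate-length : ∀ {z} → z ≡ y₁ ⊎ z ≡ y₂ → length z ≡ length (pW (3 + m))
  candidate-length (inj₁ refl) = length-map φ (pW (3 + m))
  candidate-length (inj₂ refl) = trans (length-map φ (map not (pW (3 + m)))) (length-map not (pW (3 + m)))

constant-not-primitive : ∀ {K} {w : Word K} {c} → Primitive w → 2 ≤ length w →
                         ¬ (∀ i → i < length w → at w i ≡ just c)
constant-not-primitive {w = w} {c} prim 2≤w same =
  prim ((c ∷ []) , length w , 2≤w , constant-word w c same)

lyndon-first≤last : ∀ {K} {a b : Fin K} {pw} → IsLyndon (a ∷ pw ++ b ∷ []) → ¬ (b F.< a)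
lyndon-first≤last (_ , _ , minimal) b<a
  with minimal (_ ∷ _) (_ ∷ []) refl (λ eq → FP.<-irrefl (∷-injectiveˡ eq) b<a)
... | this a<b    = FP.<-asym a<b b<a
... | next a≡b _  = FP.<-irrefl (sym a≡b) b<a

fib-lyndon⇒periods : ∀ {K} {a b : Fin K} {pw} m → IsFibLyndon a b (3 + m) (a ∷ pw ++ b ∷ []) →
                     Pattern a b pw (fib (2 + m)) (fib (1 + m)) ⊎ Pattern a b pw (fib (1 + m)) (fib (2 + m))
fib-lyndon⇒periods {K} {a} {b} {pw} m (_ , word) = Sum.[ from-y₁ , from-y₂ ] word
  where
  open FibonacciLyndon a b m
  core : ∀ {y} → a ∷ pw ++ b ∷ [] ≡ a ∷ y ++ b ∷ [] → pw ≡ y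
  core eq = ∷ʳ-injectiveˡ pw _ (∷-injectiveʳ eq)
  Periods : Word K → Set
  Periods z = Pattern a b z (fib (2 + m)) (fib (1 + m)) ⊎ Pattern a b z (fib (1 + m)) (fib (2 + m))
  from-y₁ : a ∷ pw ++ b ∷ [] ≡ a ∷ y₁ ++ b ∷ [] → Periods pw
  from-y₁ eq = subst Periods (sym (core eq)) (Sum.map proj₁ proj₁ fib-patterns)
  from-y₂ : a ∷ pw ++ b ∷ [] ≡ a ∷ y₂ ++ b ∷ [] → Periods pw
  from-y₂ eq = subst Periods (sym (core eq)) (Sum.swap (Sum.map proj₂ proj₂ fib-patterns))

periods⇒fib-lyndon : ∀ {K m P Q} {a b : Fin K} {pw} → FibPeriods m P Q → IsLyndon (a ∷ pw ++ b ∷ []) →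
                     fib (3 + m) ≤ suc (suc (length pw)) → Pattern a b pw P Q →
                     IsFibLyndon a b (3 + m) (a ∷ pw ++ b ∷ [])
periods⇒fib-lyndon {K} {m} {P} {Q} {a} {b} {pw} s lyndon long pat =
  a<b , Sum.map (cong (λ y → a ∷ y ++ b ∷ [])) (cong (λ y → a ∷ y ++ b ∷ [])) fib-word
  where
  open FibonacciLyndon a b m
  w : Word K
  w = a ∷ pw ++ b ∷ []
  M : ℕ
  M = suc (length pw)
  biperiodic : BiPeriodic (at w) M P Q
  biperiodic = pattern-biperiodic {c = a} {b} {pw} pat
  not-constant : ¬ (∀ i → i ≤ M → at w i ≡ just a)
  not-constant same = constant-not-primitive (proj₁ (proj₂ lyndon)) (s≤s (subst (1 ≤_) (sym (length-snoc pw b)) (s≤s z≤n)))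
                        (λ i lt → same i (≤-pred (subst (i <_) (cong suc (length-snoc pw b)) lt)))
  exact : suc M ≡ fib (3 + m)
  exact with m≤n⇒m<n∨m≡n long
  ... | inj₁ longer = ⊥-elim (not-constant (fib-constant s (≤-pred longer) biperiodic))
  ... | inj₂ eq     = sym eq
  a≢b : a ≢ b
  a≢b eq = not-constant (fib-unique s exact biperiodic (const-biperiodic (just a)) refl
                           (trans (at-++-length pw b []) (cong just (sym eq))))
  a<b : a F.< b
  a<b with FP.<-cmp a b
  ... | tri< lt _ _ = lt
  ... | tri≈ _ eq _ = ⊥-elim (a≢b eq)
  ... | tri> _ _ gt = ⊥-elim (lyndon-first≤last lyndon gt)
  fib-word : pw ≡ y₁ ⊎ pw ≡ y₂
  fib-word with fib-candidate s
  ... | z , patz , which = Sum.map (trans pw≡z) (trans pw≡z) which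
    where
    pw≡z : pw ≡ z
    pw≡z = pattern-unique s exact
             (suc-injective (suc-injective (trans (cong (suc ∘ suc) (candidate-length which)) (trans (length-pW m) (sym exact)))))
             pat patz

lemma10 : (k : ℕ) (w : Word k) (n : ℕ) → 3 ≤ n → IsLyndon w → fib n ≤ length w →
    (a b : Fin k) (pw : Word k) → w ≡ a ∷ (pw ++ b ∷ []) →
    IsFibLyndon a b n w ⇔
    ((HasPeriod (a ∷ pw) (fib (n ∸ 1)) × HasPeriod (pw ++ b ∷ []) (fib (n ∸ 2)))
    ⊎ (HasPeriod (a ∷ pw) (fib (n ∸ 2)) × HasPeriod (pw ++ b ∷ []) (fib (n ∸ 1))))
lemma10 k w (suc (suc (suc m))) (s≤s (s≤s (s≤s _))) lyndon long a b pw refl =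
  mk⇔ (fib-lyndon⇒periods m)
      [ periods⇒fib-lyndon {m = m} {a = a} {b} {pw} longFirst lyndon long′
      , periods⇒fib-lyndon {m = m} {a = a} {b} {pw} shortFirst lyndon long′ ]
  where
  long′ : fib (3 + m) ≤ suc (suc (length pw))
  long′ = subst (fib (3 + m) ≤_) (cong suc (length-snoc pw b)) long
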